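{- Every Hamiltonian graph $G$ is single-headed, i.e. $h(G)=|E(G)|$.
   Context: A directed 3-hypergraph $H=(V,F)$ consists of hyperarcs $u,v\to w$ (body $\{u,v\}$ of two distinct vertices, head $w$). The closure $cl_H(S)$ of $S\subseteq V$ is obtained by forward chaining: mark $S$; while some hyperarc $a,b\to c$ has $a,b$ marked and $c$ unmarked, mark $c$. $H$ represents $G=(V,E)$ if for all distinct $u,v$: $(u,v)\in E\Rightarrow cl_H(\{u,v\})=V$ and $(u,v)\notin E\Rightarrow cl_H(\{u,v\})=\{u,v\}$. The hydra number $h(G)$ is the minimum number of hyperarcs of a directed 3-hypergraph on $V$ representing $G$. -}

module Defs where

open import Data.Nat using (ℕ; zero; suc; _≤_; _<_; _∸_; _<ᵇ_)
open import Data.Fin using (Fin; toℕ)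
open import Data.Bool using (Bool; true; false; _∧_)
open import Data.List using (List; length; filterᵇ; cartesianProduct; allFin)
open import Data.List.Membership.Propositional using (_∈_)
open import Data.List.Relation.Unary.Unique.Propositional using (Unique)
open import Data.Product using (Σ; _×_; _,_; proj₁; proj₂)
open import Data.Sum using (_⊎_)
open import Function.Definitions using (Injective)
open import Relation.Binary.PropositionalEquality using (_≡_; _≢_)
open import Relation.Nullary using (¬_)

record Graph (n : ℕ) : Set where
  field
    adj    : Fin n → Fin n → Bool
    sym    : ∀ u v → adj u v ≡ adj v u
    irrefl : ∀ u → adj u u ≡ false
open Graph public

edgeCount : ∀ {n} → Graph n → ℕ
edgeCount {n} G =
  length (filterᵇ (λ p → (toℕ (proj₁ p) <ᵇ toℕ (proj₂ p)) ∧ adj G (proj₁ p) (proj₂ p))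
                  (cartesianProduct (allFin n) (allFin n)))

-- A hyperarc u,v → w with body {u,v} of two distinct vertices.  The body is
-- unordered; we store it canonically with toℕ u < toℕ v.
record Hyperarc (n : ℕ) : Set where
  constructor _,_⇒_∣_
  field
    tail₁ : Fin n
    tail₂ : Fin n
    head  : Fin n
    ordered : toℕ tail₁ < toℕ tail₂
open Hyperarc public

record Hypergraph (n : ℕ) : Set where
  field
    arcs   : List (Hyperarc n)
    unique : Unique arcs
open Hypergraph public

size : ∀ {n} → Hypergraph n → ℕ
size H = length (arcs H)

data InClosure {n : ℕ} (H : Hypergraph n) (S : Fin n → Set) : Fin n → Set where
  base : ∀ {x} → S x → InClosure H S x
  step : ∀ {a} → a ∈ arcs H →
         InClosure H S (tail₁ a) → InClosure H S (tail₂ a) →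
         InClosure H S (head a)

pair : ∀ {n} → Fin n → Fin n → Fin n → Set
pair u v x = x ≡ u ⊎ x ≡ v

Represents : ∀ {n} → Hypergraph n → Graph n → Set
Represents {n} H G =
  ∀ (u v : Fin n) → u ≢ v →
    (adj G u v ≡ true  → ∀ x → InClosure H (pair u v) x) ×
    (adj G u v ≡ false → ∀ x → InClosure H (pair u v) x → pair u v x)

HydraNumber : ∀ {n} → Graph n → ℕ → Set
HydraNumber {n} G k =
  (Σ (Hypergraph n) λ H → Represents H G × size H ≡ k) ×
  (∀ (H : Hypergraph n) → Represents H G → k ≤ size H)

-- G is Hamiltonian: n ≥ 3 and there is a cyclic ordering σ of all vertices
-- (σ bijective; injective suffices on Fin n) with consecutive vertices adjacent,
-- including σ(n-1) adjacent to σ(0).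
Hamiltonian : ∀ {n} → Graph n → Set
Hamiltonian {n} G =
  3 ≤ n ×
  Σ (Fin n → Fin n) λ σ →
    Injective _≡_ _≡_ σ ×
    (∀ i j → (toℕ j ≡ suc (toℕ i) ⊎ (toℕ i ≡ n ∸ 1 × toℕ j ≡ 0)) →
       adj G (σ i) (σ j) ≡ true)

SingleHeaded : ∀ {n} → Graph n → Set
SingleHeaded G = HydraNumber G (edgeCount G)

-- Lower bound, for every graph on at least three vertices: the closure of an
-- edge {u, v} reaches a third vertex, so some hyperarc has body exactly {u, v};
-- distinct edges therefore need distinct hyperarcs.
-- Upper bound: let next be the successor along a Hamiltonian cycle.  Give each
-- edge {u, v} one hyperarc, with head next (next u) if v = next u and next u
-- otherwise.  Then two consecutive vertices t, next t generate next (next t), so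
-- by induction around the cycle they generate everything; every edge {u, v}
-- generates the consecutive pair u, next u; and a non-edge fires no hyperarc,
-- because every body is an edge.
module Submission where

open import Defs hiding (sym)
open import Data.Bool using (Bool; true; false; T?; _∧_)
open import Data.Bool.Properties using (T-∧; T-≡)
open import Data.Fin as Fin using (Fin; toℕ; fromℕ; inject₁; punchIn; punchOut; _≟_; _<_)
open import Data.Fin.Induction using (<-weakInduction; <-weakInduction-startingFrom)
open import Data.Fin.Properties
  using (any?; injective⇒≤; punchOut-injective; punchIn-injective; punchInᵢ≢i; punchIn-punchOut;
         toℕ-fromℕ; toℕ-inject₁; ≤fromℕ; <-cmp; <-asym; <⇒≢)
open import Data.Fin.Relation.Unary.Top using (view; ‵fromℕ; ‵inject₁; view-fromℕ; view-inject₁)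
open import Data.List using (List; length; lookup; map; filterᵇ; cartesianProduct; allFin)
open import Data.List.Membership.Propositional using (_∈_; mapWith∈)
open import Data.List.Membership.Propositional.Properties
  using (∈-lookup; ∈-map⁺; ∈-filter⁺; ∈-filter⁻; ∈-cartesianProduct⁺; ∈-allFin;
         map-mapWith∈; mapWith∈-id)
open import Data.List.Membership.Setoid.Properties using (index-injective)
open import Data.List.Properties using (length-map)
open import Data.List.Relation.Binary.Subset.Propositional using (_⊆_)
open import Data.List.Relation.Unary.All as All using ()
open import Data.List.Relation.Unary.Any as Any using (here; there)
open import Data.List.Relation.Unary.Unique.Propositional using (Unique; _∷_)
open import Data.List.Relation.Unary.Unique.Propositional.Properties
  using (map⁻; filter⁺; cartesianProduct⁺; allFin⁺)
open import Data.Nat as ℕ using (ℕ; suc; _+_; _≤_; s≤s; z≤n; _<ᵇ_)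
open import Data.Nat.Properties using (1+n≰n; <ᵇ⇒<; <⇒<ᵇ; module ≤-Reasoning)
open import Data.Product using (∃-syntax; _×_; _,_; proj₁; proj₂)
open import Data.Sum using (_⊎_; inj₁; inj₂; [_,_]; swap)
open import Function using (_∘_; Equivalence)
open import Function.Definitions using (Injective; StrictlySurjective)
open import Relation.Binary.Definitions using (tri<; tri≈; tri>)
open import Relation.Binary.PropositionalEquality hiding ([_])
open import Relation.Nullary using (yes; no; ¬_; contradiction)
open import Relation.Nullary.Decidable using (_⊎-dec_)
open import Relation.Unary using (Pred; Decidable)

Unique⇒lookup-injective : ∀ {A : Set} {xs : List A} → Unique xs →
                          ∀ {i j} → lookup xs i ≡ lookup xs j → i ≡ j
Unique⇒lookup-injective (_  ∷ _) {Fin.zero}  {Fin.zero}  _ = refl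
Unique⇒lookup-injective (x∉ ∷ _) {Fin.zero}  {Fin.suc j} e = contradiction e (All.lookup x∉ (∈-lookup j))
Unique⇒lookup-injective (x∉ ∷ _) {Fin.suc i} {Fin.zero}  e = contradiction (sym e) (All.lookup x∉ (∈-lookup i))
Unique⇒lookup-injective (_  ∷ u) {Fin.suc i} {Fin.suc j} e = cong Fin.suc (Unique⇒lookup-injective u e)

Unique⇒length≤ : ∀ {A : Set} {xs ys : List A} → Unique xs → xs ⊆ ys → length xs ≤ length ys
Unique⇒length≤ {A} {xs} xs! xs⊆ys = injective⇒≤ position-injective
  where
  position : Fin (length xs) → Fin _
  position i = Any.index (xs⊆ys (∈-lookup i))
  position-injective : Injective _≡_ _≡_ position
  position-injective e =
    Unique⇒lookup-injective xs! (index-injective (setoid A) (xs⊆ys (∈-lookup _)) (xs⊆ys (∈-lookup _)) e)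

∈-mapWith∈⁺ : ∀ {A B : Set} {xs : List A} {f : ∀ {x} → x ∈ xs → B} {x} (x∈xs : x ∈ xs) →
              f x∈xs ∈ mapWith∈ xs f
∈-mapWith∈⁺ (here refl) = here refl
∈-mapWith∈⁺ (there x∈xs) = there (∈-mapWith∈⁺ x∈xs)

injective⇒strictlySurjective : ∀ {n} {f : Fin n → Fin n} →
                               Injective _≡_ _≡_ f → StrictlySurjective _≡_ f
injective⇒strictlySurjective {suc n} {f} f-injective y with any? (λ x → f x ≟ y)
... | yes hit  = hit
... | no  miss = contradiction (injective⇒≤ punchOut∘f-injective) 1+n≰n
  where
  y≢f : ∀ x → y ≢ f x
  y≢f x e = miss (x , sym e)
  punchOut∘f : Fin (suc n) → Fin n
  punchOut∘f x = punchOut (y≢f x)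
  punchOut∘f-injective : Injective _≡_ _≡_ punchOut∘f
  punchOut∘f-injective e = f-injective (punchOut-injective (y≢f _) (y≢f _) e)

∃-outside-pair : ∀ {n} {u v : Fin (3 + n)} → u ≢ v → ∃[ w ] ¬ pair u v w
∃-outside-pair {u = u} {v} u≢v = punchIn u w′ , [ punchInᵢ≢i u w′ , w≢v ]
  where
  v′ = punchOut u≢v
  w′ = punchIn v′ Fin.zero
  w≢v : punchIn u w′ ≢ v
  w≢v e = punchInᵢ≢i v′ Fin.zero (punchIn-injective u w′ v′ (trans e (sym (punchIn-punchOut u≢v))))

cyclicSuc : ∀ {m} → Fin (suc m) → Fin (suc m)
cyclicSuc i with view i
... | ‵fromℕ     = Fin.zero
... | ‵inject₁ j = Fin.suc j

cyclicSuc-fromℕ : ∀ m → cyclicSuc (fromℕ m) ≡ Fin.zero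
cyclicSuc-fromℕ m rewrite view-fromℕ m = refl

cyclicSuc-inject₁ : ∀ {m} (j : Fin m) → cyclicSuc (inject₁ j) ≡ Fin.suc j
cyclicSuc-inject₁ j rewrite view-inject₁ j = refl

toℕ-cyclicSuc : ∀ {m} (i : Fin (suc m)) →
                toℕ (cyclicSuc i) ≡ suc (toℕ i) ⊎ (toℕ i ≡ m × toℕ (cyclicSuc i) ≡ 0)
toℕ-cyclicSuc i with view i
... | ‵fromℕ     = inj₂ (toℕ-fromℕ _ , refl)
... | ‵inject₁ j = inj₁ (cong suc (sym (toℕ-inject₁ j)))

cyclicSuc-induction : ∀ {m ℓ} (P : Pred (Fin (suc m)) ℓ) → (∀ i → P i → P (cyclicSuc i)) →
                      ∀ {i} → P i → ∀ j → P j
cyclicSuc-induction {m} P P-step {i} Pi = <-weakInduction P P-zero P-suc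
  where
  P-suc : ∀ j → P (inject₁ j) → P (Fin.suc j)
  P-suc j = subst P (cyclicSuc-inject₁ j) ∘ P-step (inject₁ j)
  P-zero : P Fin.zero
  P-zero = subst P (cyclicSuc-fromℕ m)
             (P-step _ (<-weakInduction-startingFrom P Pi P-suc (≤fromℕ i)))

module _ {n} {H : Hypergraph n} where

  InClosure-mono : ∀ {S S′ : Fin n → Set} → (∀ {x} → S x → S′ x) →
                   ∀ {x} → InClosure H S x → InClosure H S′ x
  InClosure-mono S⊆S′ (base x∈S)        = base (S⊆S′ x∈S)
  InClosure-mono S⊆S′ (step a∈H c₁ c₂) = step a∈H (InClosure-mono S⊆S′ c₁) (InClosure-mono S⊆S′ c₂)

  escapingArc : ∀ {S : Fin n → Set} → Decidable S → ∀ {x} → InClosure H S x → ¬ S x →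
                ∃[ a ] a ∈ arcs H × S (tail₁ a) × S (tail₂ a)
  escapingArc S? (base x∈S) x∉S = contradiction x∈S x∉S
  escapingArc S? (step {a} a∈H c₁ c₂) _ with S? (tail₁ a) | S? (tail₂ a)
  ... | yes t₁∈S | yes t₂∈S = a , a∈H , t₁∈S , t₂∈S
  ... | no  t₁∉S | _        = escapingArc S? c₁ t₁∉S
  ... | yes _    | no  t₂∉S = escapingArc S? c₂ t₂∉S

pair? : ∀ {n} (u v : Fin n) → Decidable (pair u v)
pair? u v w = (w ≟ u) ⊎-dec (w ≟ v)

tails∈pair : ∀ {n} {u v : Fin n} (a : Hyperarc n) → pair u v (tail₁ a) → pair u v (tail₂ a) →
             (tail₁ a ≡ u × tail₂ a ≡ v) ⊎ (tail₁ a ≡ v × tail₂ a ≡ u)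
tails∈pair a (inj₁ t₁≡u) (inj₂ t₂≡v) = inj₁ (t₁≡u , t₂≡v)
tails∈pair a (inj₂ t₁≡v) (inj₁ t₂≡u) = inj₂ (t₁≡v , t₂≡u)
tails∈pair a (inj₁ t₁≡u) (inj₁ t₂≡u) = contradiction (trans t₁≡u (sym t₂≡u)) (<⇒≢ (ordered a))
tails∈pair a (inj₂ t₁≡v) (inj₂ t₂≡v) = contradiction (trans t₁≡v (sym t₂≡v)) (<⇒≢ (ordered a))

body : ∀ {n} → Hyperarc n → Fin n × Fin n
body a = tail₁ a , tail₂ a

module _ {n} (G : Graph n) where

  isEdge : Fin n × Fin n → Bool
  isEdge (u , v) = (toℕ u <ᵇ toℕ v) ∧ adj G u v

  allPairs : List (Fin n × Fin n)
  allPairs = cartesianProduct (allFin n) (allFin n)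

  edges : List (Fin n × Fin n)
  edges = filterᵇ isEdge allPairs

  edges-unique : Unique edges
  edges-unique = filter⁺ (T? ∘ isEdge) (cartesianProduct⁺ (allFin⁺ n) (allFin⁺ n))

  ∈-edges⁻ : ∀ {u v} → (u , v) ∈ edges → u < v × adj G u v ≡ true
  ∈-edges⁻ {u} {v} uv∈E
    with u<ᵇv , uv∈G ← Equivalence.to T-∧ (proj₂ (∈-filter⁻ (T? ∘ isEdge) {xs = allPairs} uv∈E))
    = <ᵇ⇒< (toℕ u) (toℕ v) u<ᵇv , Equivalence.to T-≡ uv∈G

  ∈-edges⁺ : ∀ {u v} → u < v → adj G u v ≡ true → (u , v) ∈ edges
  ∈-edges⁺ {u} {v} u<v uv∈G =
    ∈-filter⁺ (T? ∘ isEdge) (∈-cartesianProduct⁺ (∈-allFin u) (∈-allFin v))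
      (Equivalence.from T-∧ (<⇒<ᵇ u<v , Equivalence.from T-≡ uv∈G))

tails∈pair⇒body≡ : ∀ {n} {u v : Fin n} (a : Hyperarc n) → u < v →
                   pair u v (tail₁ a) → pair u v (tail₂ a) →
                   body a ≡ (u , v)
tails∈pair⇒body≡ a u<v t₁∈uv t₂∈uv with tails∈pair a t₁∈uv t₂∈uv
... | inj₁ (refl , refl) = refl
... | inj₂ (refl , refl) = contradiction (ordered a) (<-asym u<v)

edgeCount≤size : ∀ {k} (G : Graph (3 + k)) (H : Hypergraph (3 + k)) → Represents H G →
                 edgeCount G ≤ size H
edgeCount≤size G H represents = begin
  edgeCount G                ≤⟨ Unique⇒length≤ (edges-unique G) edge⇒body ⟩
  length (map body (arcs H)) ≡⟨ length-map body (arcs H) ⟩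
  size H                     ∎
  where
  open ≤-Reasoning
  edge⇒body : edges G ⊆ map body (arcs H)
  edge⇒body {u , v} uv∈E =
    let u<v , uv∈G            = ∈-edges⁻ G uv∈E
        u≢v                   = <⇒≢ u<v
        w , w∉uv              = ∃-outside-pair u≢v
        a , a∈H , t₁∈uv , t₂∈uv = escapingArc (pair? u v) (proj₁ (represents u v u≢v) uv∈G w) w∉uv
    in subst (_∈ map body (arcs H)) (tails∈pair⇒body≡ a u<v t₁∈uv t₂∈uv) (∈-map⁺ body a∈H)

module EdgeHypergraph {n} (G : Graph n) (hd : Fin n → Fin n → Fin n) where

  arcOn : ∀ {e} → e ∈ edges G → Hyperarc n
  arcOn {u , v} uv∈E = u , v ⇒ hd u v ∣ proj₁ (∈-edges⁻ G uv∈E)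

  bodies≡edges : map body (mapWith∈ (edges G) arcOn) ≡ edges G
  bodies≡edges = trans (map-mapWith∈ (edges G) arcOn body) (mapWith∈-id (edges G))

  edgeHypergraph : Hypergraph n
  edgeHypergraph = record
    { arcs   = mapWith∈ (edges G) arcOn
    ; unique = map⁻ (subst Unique (sym bodies≡edges) (edges-unique G))
    }

  size-edgeHypergraph : size edgeHypergraph ≡ edgeCount G
  size-edgeHypergraph = trans (sym (length-map body (arcs edgeHypergraph))) (cong length bodies≡edges)

  ∈-edgeHypergraph⁻ : ∀ {a} → a ∈ arcs edgeHypergraph → adj G (tail₁ a) (tail₂ a) ≡ true
  ∈-edgeHypergraph⁻ {a} a∈H = proj₂ (∈-edges⁻ G (subst (body a ∈_) bodies≡edges (∈-map⁺ body a∈H)))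

  fire : ∀ {S u v} → u < v → adj G u v ≡ true →
         InClosure edgeHypergraph S u → InClosure edgeHypergraph S v → InClosure edgeHypergraph S (hd u v)
  fire u<v uv∈G = step (∈-mapWith∈⁺ (∈-edges⁺ G u<v uv∈G))

  nonEdge-closed : ∀ {u v} → adj G u v ≡ false →
                   ∀ {x} → InClosure edgeHypergraph (pair u v) x → pair u v x
  nonEdge-closed uv∉G (base x∈uv) = x∈uv
  nonEdge-closed uv∉G (step {a} a∈H c₁ c₂)
    with tails∈pair a (nonEdge-closed uv∉G c₁) (nonEdge-closed uv∉G c₂)
  ... | inj₁ (refl , refl) = contradiction (trans (sym (∈-edgeHypergraph⁻ a∈H)) uv∉G) λ ()
  ... | inj₂ (refl , refl) =
    contradiction (trans (sym (∈-edgeHypergraph⁻ a∈H)) (trans (Graph.sym G _ _) uv∉G)) λ ()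

module HamiltonianCycle {k} (G : Graph (3 + k)) (σ : Fin (3 + k) → Fin (3 + k))
  (σ-injective : Injective _≡_ _≡_ σ)
  (σ-cycle : ∀ i j → toℕ j ≡ suc (toℕ i) ⊎ (toℕ i ≡ 2 + k × toℕ j ≡ 0) → adj G (σ i) (σ j) ≡ true)
  where

  V : Set
  V = Fin (3 + k)

  position : V → Fin (3 + k)
  position v = proj₁ (injective⇒strictlySurjective σ-injective v)

  σ∘position : ∀ v → σ (position v) ≡ v
  σ∘position v = proj₂ (injective⇒strictlySurjective σ-injective v)

  position∘σ : ∀ i → position (σ i) ≡ i
  position∘σ i = σ-injective (σ∘position (σ i))

  next : V → V
  next v = σ (cyclicSuc (position v))

  adj-next : ∀ v → adj G v (next v) ≡ true
  adj-next v = subst (λ u → adj G u (next v) ≡ true) (σ∘position v)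
                 (σ-cycle _ _ (toℕ-cyclicSuc (position v)))

  next≢ : ∀ v → next v ≢ v
  next≢ v nv≡v =
    contradiction (trans (sym (subst (λ w → adj G v w ≡ true) nv≡v (adj-next v))) (irrefl G v)) λ ()

  next-induction : ∀ {ℓ} (P : Pred V ℓ) → (∀ v → P v → P (next v)) → ∀ {v} → P v → ∀ w → P w
  next-induction P P-step {v} Pv w = subst P (σ∘position w)
    (cyclicSuc-induction (P ∘ σ) P∘σ-step (subst P (sym (σ∘position v)) Pv) (position w))
    where
    P∘σ-step : ∀ i → P (σ i) → P (σ (cyclicSuc i))
    P∘σ-step i = subst (λ j → P (σ (cyclicSuc j))) (position∘σ i) ∘ P-step (σ i)

  -- Otherwise {v, next v} is closed under next, hence all of V, yet V has a third vertex.
  next²≢ : ∀ v → next (next v) ≢ v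
  next²≢ v nnv≡v =
    proj₂ outside (next-induction (pair v (next v)) orbit-closed (inj₁ refl) (proj₁ outside))
    where
    outside = ∃-outside-pair (next≢ v ∘ sym)
    orbit-closed : ∀ w → pair v (next v) w → pair v (next v) (next w)
    orbit-closed w (inj₁ w≡v)  = inj₂ (cong next w≡v)
    orbit-closed w (inj₂ w≡nv) = inj₁ (trans (cong next w≡nv) nnv≡v)

  -- By next²≢, both (t, next t) and (next t, t) are sent to next (next t), so the
  -- arc on a cycle edge is right whichever way round its body is stored.
  headFor : V → V → V
  headFor u v with v ≟ next u
  ... | yes _ = next v
  ... | no  _ = next u

  headFor-next : ∀ t → headFor t (next t) ≡ next (next t)
  headFor-next t with next t ≟ next t
  ... | yes _    = refl
  ... | no  nt≢nt = contradiction refl nt≢nt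

  headFor-¬next : ∀ {u v} → v ≢ next u → headFor u v ≡ next u
  headFor-¬next {u} {v} v≢nu with v ≟ next u
  ... | yes v≡nu = contradiction v≡nu v≢nu
  ... | no  _    = refl

  open EdgeHypergraph G headFor

  next²-reached : ∀ {S} t → InClosure edgeHypergraph S t → InClosure edgeHypergraph S (next t) →
                  InClosure edgeHypergraph S (next (next t))
  next²-reached {S} t ct cnt with <-cmp t (next t)
  ... | tri< t<nt _ _ = subst (InClosure edgeHypergraph S) (headFor-next t) (fire t<nt (adj-next t) ct cnt)
  ... | tri≈ _ t≡nt _ = contradiction (sym t≡nt) (next≢ t)
  ... | tri> _ _ nt<t = subst (InClosure edgeHypergraph S) (headFor-¬next (next²≢ t ∘ sym))
                          (fire nt<t (trans (Graph.sym G _ _) (adj-next t)) cnt ct)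

  consecutive⇒all : ∀ {S} t → InClosure edgeHypergraph S t → InClosure edgeHypergraph S (next t) →
                    ∀ x → InClosure edgeHypergraph S x
  consecutive⇒all {S} t ct cnt x =
    proj₁ (next-induction Consecutive (λ v (cv , cnv) → cnv , next²-reached v cv cnv) (ct , cnt) x)
    where
    Consecutive : V → Set
    Consecutive v = InClosure edgeHypergraph S v × InClosure edgeHypergraph S (next v)

  next-reached : ∀ {u v} → u < v → adj G u v ≡ true → InClosure edgeHypergraph (pair u v) (next u)
  next-reached {u} {v} u<v uv∈G with v ≟ next u
  ... | yes v≡nu = base (inj₂ (sym v≡nu))
  ... | no  v≢nu = subst (InClosure edgeHypergraph (pair u v)) (headFor-¬next v≢nu)
                     (fire u<v uv∈G (base (inj₁ refl)) (base (inj₂ refl)))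

  ordered-edge⇒all : ∀ {u v} → u < v → adj G u v ≡ true → ∀ x → InClosure edgeHypergraph (pair u v) x
  ordered-edge⇒all u<v uv∈G = consecutive⇒all _ (base (inj₁ refl)) (next-reached u<v uv∈G)

  edge⇒all : ∀ {u v} → u ≢ v → adj G u v ≡ true → ∀ x → InClosure edgeHypergraph (pair u v) x
  edge⇒all {u} {v} u≢v uv∈G with <-cmp u v
  ... | tri< u<v _ _ = ordered-edge⇒all u<v uv∈G
  ... | tri≈ _ u≡v _ = contradiction u≡v u≢v
  ... | tri> _ _ v<u = λ x → InClosure-mono swap (ordered-edge⇒all v<u (trans (Graph.sym G v u) uv∈G) x)

  represents : Represents edgeHypergraph G
  represents u v u≢v = edge⇒all u≢v , λ uv∉G _ → nonEdge-closed uv∉G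

proposition3p3 : ∀ (n : ℕ) (G : Graph n) → Hamiltonian G → SingleHeaded G
proposition3p3 .(3 + k) G (s≤s (s≤s (s≤s (z≤n {k}))) , σ , σ-injective , σ-cycle) =
  (edgeHypergraph , represents , size-edgeHypergraph) , edgeCount≤size G
  where
  open HamiltonianCycle G σ σ-injective σ-cycle
  open EdgeHypergraph G headFor
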